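{- Let $u\ge 1$, $m=2u$, $n=2^m-1$, $r=2^u+1$. Let $\alpha$ be a primitive element of $\mathbb{F}_{2^m}$ and write every element of $\mathbb{F}_{2^m}$ uniquely as $\gamma_1+\gamma_2\alpha$ with $\gamma_1,\gamma_2\in\mathbb{F}_{2^u}$; for $j=0,\dots,n-1$ write $\alpha^j=\gamma_{j1}+\gamma_{j2}\alpha$. Let $H_m$ (resp. $E_m$) be the $m\times n$ binary matrix whose $j$-th column ($j=0,\dots,n-1$) is the binary representation, with respect to a fixed $\mathbb{F}_2$-basis of $\mathbb{F}_{2^m}$, of $\alpha^j$ (resp. of $\alpha^{jr}$), and let $C^{(u)}=\{\mathbf{v}\in\mathbb{F}_2^n: H_m\mathbf{v}^T=0,\ E_m\mathbf{v}^T=0\}$. For $\mathbf{v}\in\mathbb{F}_2^n$ put $S(\mathbf{v})=\sum_{j\in\operatorname{Supp}(\mathbf{v})}\gamma_{j1}\gamma_{j2}\in\mathbb{F}_{2^u}$. Then $$C^{(u)}=\{\mathbf{v}\in\mathbb{F}_2^n:\ H_m\mathbf{v}^T=0 \text{ and } S(\mathbf{v})=0\}.$$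
   Context: $\operatorname{Supp}(\mathbf{v})$ is the set of coordinates where $\mathbf{v}$ is nonzero; coordinates of $\mathbb{F}_2^n$ are indexed by $j=0,\dots,n-1$. Since $m=2u$, $\mathbb{F}_{2^u}\subset\mathbb{F}_{2^m}$ and $\{1,\alpha\}$ is a basis of $\mathbb{F}_{2^m}$ over $\mathbb{F}_{2^u}$. -}

module Defs where

open import Data.Nat using (ℕ; zero; suc; _∸_; _*_) renaming (_^_ to _^ℕ_)
open import Data.Fin using (Fin; zero; suc; toℕ)
open import Data.Bool using (Bool; true; false; if_then_else_; _xor_; _∧_)
open import Data.Product using (Σ; ∃; _×_; _,_)
open import Relation.Binary.PropositionalEquality using (_≡_; _≢_)
open import Function.Bundles using (_↔_)
open import Algebra.Structures using (IsCommutativeRing)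

fsum : {A : Set} → (A → A → A) → A → {n : ℕ} → (Fin n → A) → A
fsum _⊕_ e {zero}  f = e
fsum _⊕_ e {suc n} f = f zero ⊕ fsum _⊕_ e (λ j → f (suc j))

record FiniteField (q : ℕ) : Set₁ where
  field
    Carrier : Set
    _+_ : Carrier → Carrier → Carrier
    _·_ : Carrier → Carrier → Carrier
    -_  : Carrier → Carrier
    0# : Carrier
    1# : Carrier
    isCommutativeRing : IsCommutativeRing _≡_ _+_ _·_ -_ 0# 1#
    0≢1 : 0# ≢ 1#
    inverse : ∀ x → x ≢ 0# → ∃ λ y → x · y ≡ 1#
    card : Carrier ↔ Fin q

  infixl 6 _+_
  infixl 7 _·_

  _^_ : Carrier → ℕ → Carrier
  x ^ zero  = 1#
  x ^ suc k = x · (x ^ k)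

  Σ[_] : {n : ℕ} → (Fin n → Carrier) → Carrier
  Σ[ f ] = fsum _+_ 0# f

  Primitive : Carrier → Set
  Primitive α = ∀ x → x ≢ 0# → ∃ λ j → α ^ j ≡ x

  -- membership in the subfield F_{2^u} = { x | x^(2^u) = x }
  InSubfield : ℕ → Carrier → Set
  InSubfield u x = x ^ (2 ^ℕ u) ≡ x

  combo : {k : ℕ} → (Fin k → Carrier) → (Fin k → Bool) → Carrier
  combo b c = Σ[ (λ i → if c i then b i else 0#) ]

  IsCoordinates : {k : ℕ} → (Fin k → Carrier) → (Carrier → Fin k → Bool) → Set
  IsCoordinates b rep =
    (∀ x → combo b (rep x) ≡ x) × (∀ c i → rep (combo b c) i ≡ c i)

MulVecZero : {k n : ℕ} → (Fin k → Fin n → Bool) → (Fin n → Bool) → Set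
MulVecZero M v = ∀ i → fsum _xor_ false (λ j → M i j ∧ v j) ≡ false

-- Write q = 2^u and β = α^q. Since x ↦ x^q is additive (characteristic 2) and fixes F_{2^u},
-- z = a + bα with a, b ∈ F_{2^u} has conjugate z^q = a + bβ and norm
-- z^(q+1) = a² + (α + β)ab + βα b². As coordinates are F₂-linear, H vᵀ = 0 says
-- Σ_{j ∈ Supp v} αʲ = 0; conjugating, both Σ γ_{j1} and Σ γ_{j2} vanish, and since squaring is
-- additive the sum of the norms, which is what E vᵀ = 0 tests, collapses to (α + β) S(v).
-- Here α + β ≠ 0 because α ∉ F_{2^u}. Both characteristic 2 and α^q ≠ α come from α having
-- order 2^m − 1, which is odd and larger than q − 1.
module Submission where

open import Defs
open import Level using (0ℓ)
open import Data.Nat using (ℕ; zero; suc; _≤_; _<_; _∸_; z≤n; s≤s; NonZero; >-nonZero; s≤s⁻¹)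
  renaming (_*_ to _*ℕ_; _+_ to _+ℕ_; _^_ to _^ℕ_)
import Data.Nat.Properties as ℕ
open import Data.Nat.DivMod using (_%_; _/_; m≡m%n+[m/n]*n; m%n<n)
open import Data.Nat.Divisibility using (_∣_; divides; m%n≡0⇒n∣m)
open import Data.Nat.Coprimality using (Coprime; 1-coprimeTo; coprime-+; coprime-divisor)
open import Data.Fin using (Fin; toℕ; fromℕ<; cast; punchOut)
import Data.Fin.Properties as Fin
open import Data.Bool using (Bool; true; false; _xor_; _∧_; if_then_else_)
import Data.Bool.Properties as Bool
open import Data.Product using (_×_; _,_; proj₁; proj₂; ∃)
open import Relation.Nullary using (Dec; yes; no; contradiction)
open import Relation.Binary.PropositionalEquality
open import Function using (_∘_)
open import Function.Bundles using (_⇔_; mk⇔; Injection; Equivalence)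
open import Function.Properties.Inverse using (↔⇒↣; ↔-sym)
open import Algebra.Structures using (IsCommutativeRing)
open import Algebra.Bundles using (CommutativeRing)
import Function.Properties.Equivalence as ⇔
import Algebra.Properties.CommutativeSemiring.Exp as Exp
import Algebra.Properties.Semiring.Sum as Sum
import Algebra.Properties.Ring as RingProperties
import Algebra.Solver.Ring.NaturalCoefficients.Default as Solver

module FiniteFieldProperties {Q : ℕ} (F : FiniteField Q) where
  open FiniteField F public
  open IsCommutativeRing isCommutativeRing public
    using (+-assoc; *-assoc; *-comm; zeroˡ; zeroʳ; +-identityˡ; +-identityʳ; *-identityˡ; *-identityʳ; -‿inverseʳ)

  commutativeRing : CommutativeRing 0ℓ 0ℓ
  commutativeRing = record { isCommutativeRing = isCommutativeRing }

  open CommutativeRing commutativeRing using (commutativeSemiring; semiring; ring)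
  open Solver commutativeSemiring public using (solve; _:+_; _:*_; _:=_; con)

  private
    module E = Exp commutativeSemiring
    module S = Sum semiring

  ^≡^ᴱ : ∀ x n → x ^ n ≡ x E.^ n
  ^≡^ᴱ x zero    = refl
  ^≡^ᴱ x (suc n) = cong (x ·_) (^≡^ᴱ x n)

  ^-homo-· : ∀ x m n → x ^ (m +ℕ n) ≡ x ^ m · x ^ n
  ^-homo-· x m n
    rewrite ^≡^ᴱ x (m +ℕ n) | ^≡^ᴱ x m | ^≡^ᴱ x n = E.^-homo-* x m n

  ^-assoc : ∀ x m n → x ^ (m *ℕ n) ≡ (x ^ m) ^ n
  ^-assoc x m n
    rewrite ^≡^ᴱ x (m *ℕ n) | ^≡^ᴱ (x ^ m) n | ^≡^ᴱ x m = sym (E.^-assocʳ x m n)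

  ^-distrib-· : ∀ x y n → (x · y) ^ n ≡ x ^ n · y ^ n
  ^-distrib-· x y n
    rewrite ^≡^ᴱ (x · y) n | ^≡^ᴱ x n | ^≡^ᴱ y n = E.^-distrib-* x y n

  1^ : ∀ n → 1# ^ n ≡ 1#
  1^ zero    = refl
  1^ (suc n) = trans (*-identityˡ _) (1^ n)

  x^2≡x·x : ∀ x → x ^ 2 ≡ x · x
  x^2≡x·x x = cong (x ·_) (*-identityʳ x)

  0^ : ∀ n → 0 < n → 0# ^ n ≡ 0#
  0^ (suc n) _ = zeroˡ _

  ^-% : ∀ x e .{{_ : NonZero e}} → x ^ e ≡ 1# → ∀ j → x ^ j ≡ x ^ (j % e)
  ^-% x e x^e≡1 j = begin
    x ^ j                                 ≡⟨ cong (x ^_) (m≡m%n+[m/n]*n j e) ⟩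
    x ^ (j % e +ℕ (j / e) *ℕ e)           ≡⟨ ^-homo-· x (j % e) _ ⟩
    x ^ (j % e) · x ^ ((j / e) *ℕ e)      ≡⟨ cong (λ k → x ^ (j % e) · x ^ k) (ℕ.*-comm (j / e) e) ⟩
    x ^ (j % e) · x ^ (e *ℕ (j / e))      ≡⟨ cong (x ^ (j % e) ·_) (^-assoc x e (j / e)) ⟩
    x ^ (j % e) · (x ^ e) ^ (j / e)       ≡⟨ cong (λ y → x ^ (j % e) · y ^ (j / e)) x^e≡1 ⟩
    x ^ (j % e) · 1# ^ (j / e)            ≡⟨ cong (x ^ (j % e) ·_) (1^ (j / e)) ⟩
    x ^ (j % e) · 1#                      ≡⟨ *-identityʳ _ ⟩
    x ^ (j % e)                           ∎
    where open ≡-Reasoning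

  -1·-1≡1 : - 1# · - 1# ≡ 1#
  -1·-1≡1 = trans (-1*x≈-x (- 1#)) (-‿involutive 1#)
    where open RingProperties ring using (-1*x≈-x; -‿involutive)

  Σ≡sumˢ : ∀ {k} (f : Fin k → Carrier) → Σ[ f ] ≡ S.sum f
  Σ≡sumˢ {zero}  f = refl
  Σ≡sumˢ {suc k} f = cong (f Fin.zero +_) (Σ≡sumˢ (f ∘ Fin.suc))

  Σ-cong : ∀ {k} {f g : Fin k → Carrier} → (∀ j → f j ≡ g j) → Σ[ f ] ≡ Σ[ g ]
  Σ-cong {f = f} {g} f≗g rewrite Σ≡sumˢ f | Σ≡sumˢ g = S.sum-cong-≗ f≗g

  Σ-distrib-+ : ∀ {k} (f g : Fin k → Carrier) → Σ[ (λ j → f j + g j) ] ≡ Σ[ f ] + Σ[ g ]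
  Σ-distrib-+ f g
    rewrite Σ≡sumˢ (λ j → f j + g j) | Σ≡sumˢ f | Σ≡sumˢ g = S.∑-distrib-+ f g

  Σ-distribˡ-· : ∀ {k} c (f : Fin k → Carrier) → Σ[ (λ j → c · f j) ] ≡ c · Σ[ f ]
  Σ-distribˡ-· c f
    rewrite Σ≡sumˢ (λ j → c · f j) | Σ≡sumˢ f = sym (S.*-distribˡ-sum c f)

  Σ-distribʳ-· : ∀ {k} c (f : Fin k → Carrier) → Σ[ (λ j → f j · c) ] ≡ Σ[ f ] · c
  Σ-distribʳ-· c f
    rewrite Σ≡sumˢ (λ j → f j · c) | Σ≡sumˢ f = sym (S.*-distribʳ-sum c f)

  Σ-zero : ∀ k → Σ[ (λ (_ : Fin k) → 0#) ] ≡ 0#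
  Σ-zero k rewrite Σ≡sumˢ (λ (_ : Fin k) → 0#) = S.sum-replicate-zero k

  -- The F₂-scalar action; a sum Σ[ (λ j → v j ·ᵇ x j) ] is the sum of x over Supp(v).
  infixr 7 _·ᵇ_
  _·ᵇ_ : Bool → Carrier → Carrier
  c ·ᵇ x = if c then x else 0#

  ·ᵇ-distrib-+ : ∀ c x y → c ·ᵇ (x + y) ≡ c ·ᵇ x + c ·ᵇ y
  ·ᵇ-distrib-+ true  x y = refl
  ·ᵇ-distrib-+ false x y = sym (+-identityˡ 0#)

  ·ᵇ-assoc : ∀ c x y → c ·ᵇ (x · y) ≡ (c ·ᵇ x) · y
  ·ᵇ-assoc true  x y = refl
  ·ᵇ-assoc false x y = sym (zeroˡ y)

  ·ᵇ-distrib-· : ∀ c x y → c ·ᵇ (x · y) ≡ (c ·ᵇ x) · (c ·ᵇ y)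
  ·ᵇ-distrib-· true  x y = refl
  ·ᵇ-distrib-· false x y = sym (zeroˡ 0#)

  ·ᵇ-^ : ∀ c x k → 0 < k → c ·ᵇ (x ^ k) ≡ (c ·ᵇ x) ^ k
  ·ᵇ-^ true  x k _   = refl
  ·ᵇ-^ false x k 0<k = sym (0^ k 0<k)

  ≡0⇔≡0 : ∀ {x y} → x ≡ y → (x ≡ 0#) ⇔ (y ≡ 0#)
  ≡0⇔≡0 x≡y = mk⇔ (trans (sym x≡y)) (trans x≡y)

  inverse-cancelˡ : ∀ {x y} → x · y ≡ 1# → ∀ z → y · (x · z) ≡ z
  inverse-cancelˡ {x} {y} xy≡1 z = begin
    y · (x · z)  ≡⟨ sym (*-assoc y x z) ⟩
    (y · x) · z  ≡⟨ cong (_· z) (trans (*-comm y x) xy≡1) ⟩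
    1# · z       ≡⟨ *-identityˡ z ⟩
    z            ∎
    where open ≡-Reasoning

  ·-cancelˡ : ∀ {x y z} → x ≢ 0# → x · y ≡ x · z → y ≡ z
  ·-cancelˡ {x} {y} {z} x≢0 xy≡xz with inverse x x≢0
  ... | x⁻¹ , xx⁻¹≡1 =
    trans (sym (inverse-cancelˡ xx⁻¹≡1 y))
          (trans (cong (x⁻¹ ·_) xy≡xz) (inverse-cancelˡ xx⁻¹≡1 z))

  x·y≡0⇒y≡0 : ∀ {x y} → x ≢ 0# → x · y ≡ 0# → y ≡ 0#
  x·y≡0⇒y≡0 {x} x≢0 xy≡0 = ·-cancelˡ x≢0 (trans xy≡0 (sym (zeroʳ x)))

  ^-nonzero : ∀ {x} → x ≢ 0# → ∀ n → x ^ n ≢ 0#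
  ^-nonzero x≢0 zero    1≡0  = 0≢1 (sym 1≡0)
  ^-nonzero x≢0 (suc n) xⁿ⁺¹≡0 = ^-nonzero x≢0 n (x·y≡0⇒y≡0 x≢0 xⁿ⁺¹≡0)

  x^i≡x^j⇒x^[j∸i]≡1 : ∀ {x i j} → x ≢ 0# → i ≤ j → x ^ i ≡ x ^ j → x ^ (j ∸ i) ≡ 1#
  x^i≡x^j⇒x^[j∸i]≡1 {x} {i} {j} x≢0 i≤j xⁱ≡xʲ = sym (·-cancelˡ (^-nonzero x≢0 i) (begin
    x ^ i · 1#           ≡⟨ *-identityʳ _ ⟩
    x ^ i                ≡⟨ xⁱ≡xʲ ⟩
    x ^ j                ≡⟨ cong (x ^_) (sym (ℕ.m+[n∸m]≡n i≤j)) ⟩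
    x ^ (i +ℕ (j ∸ i))   ≡⟨ ^-homo-· x i (j ∸ i) ⟩
    x ^ i · x ^ (j ∸ i)  ∎))
    where open ≡-Reasoning

  -1≢0 : - 1# ≢ 0#
  -1≢0 -1≡0 = 0≢1 (sym (trans (sym (+-identityʳ 1#)) (trans (cong (1# +_) (sym -1≡0)) (-‿inverseʳ 1#))))

  open Injection (↔⇒↣ card) public using () renaming (to to toFin; injective to toFin-injective)

  _≟_ : (x y : Carrier) → Dec (x ≡ y)
  _≟_ = Fin.inj⇒≟ (↔⇒↣ card)

  card-≤ : ∀ {k} (code : Carrier → Fin k) → (∀ {x y} → code x ≡ code y → x ≡ y) → Q ≤ k
  card-≤ code code-injective =
    Fin.injective⇒≤ {f = code ∘ from} (from-injective ∘ code-injective)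
    where open Injection (↔⇒↣ (↔-sym card)) using () renaming (to to from; injective to from-injective)

module PrimitiveElement {Q : ℕ} (F : FiniteField Q)
                        (α : FiniteField.Carrier F) (prim : FiniteField.Primitive F α) where
  open FiniteFieldProperties F

  module _ (e : ℕ) (powers-cover : ∀ x → x ≢ 0# → ∃ λ i → i < e × α ^ i ≡ x) where
    private
      log : (x : Carrier) → Dec (x ≡ 0#) → ℕ
      log x (yes _)   = e
      log x (no x≢0) = proj₁ (powers-cover x x≢0)

      log< : ∀ x (d : Dec (x ≡ 0#)) → log x d < suc e
      log< x (yes _)   = ℕ.n<1+n e
      log< x (no x≢0) = ℕ.m<n⇒m<1+n (proj₁ (proj₂ (powers-cover x x≢0)))

      log-injective : ∀ x y (dx : Dec (x ≡ 0#)) (dy : Dec (y ≡ 0#)) → log x dx ≡ log y dy → x ≡ y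
      log-injective x y (yes x≡0) (yes y≡0) _ = trans x≡0 (sym y≡0)
      log-injective x y (yes _) (no y≢0) e≡i =
        contradiction (subst (_< e) (sym e≡i) (proj₁ (proj₂ (powers-cover y y≢0)))) (ℕ.<-irrefl refl)
      log-injective x y (no x≢0) (yes _) i≡e =
        contradiction (subst (_< e) i≡e (proj₁ (proj₂ (powers-cover x x≢0)))) (ℕ.<-irrefl refl)
      log-injective x y (no x≢0) (no y≢0) i≡j =
        trans (sym (proj₂ (proj₂ (powers-cover x x≢0))))
              (trans (cong (α ^_) i≡j) (proj₂ (proj₂ (powers-cover y y≢0))))

    powers-cover⇒Q≤1+e : Q ≤ suc e
    powers-cover⇒Q≤1+e = card-≤ (λ x → fromℕ< (log< x (x ≟ 0#))) λ {x} {y} eq →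
      log-injective x y (x ≟ 0#) (y ≟ 0#) (trans (sym (Fin.toℕ-fromℕ< _)) (trans (cong toℕ eq) (Fin.toℕ-fromℕ< _)))

  α^e≡1⇒Q≤1+e : ∀ {e} → 0 < e → α ^ e ≡ 1# → Q ≤ suc e
  α^e≡1⇒Q≤1+e {e@(suc _)} _ α^e≡1 = powers-cover⇒Q≤1+e e λ x x≢0 →
    let (j , αʲ≡x) = prim x x≢0
    in j % e , m%n<n j e , trans (sym (^-% α e α^e≡1 j)) αʲ≡x

  α≢0 : 2 < Q → α ≢ 0#
  α≢0 2<Q α≡0 = ℕ.<⇒≱ 2<Q (powers-cover⇒Q≤1+e 1 cover)
    where
    cover : ∀ x → x ≢ 0# → ∃ λ i → i < 1 × α ^ i ≡ x
    cover x x≢0 with prim x x≢0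
    ... | zero  , α⁰≡x = 0 , s≤s z≤n , α⁰≡x
    ... | suc j , αʲ≡x = contradiction (trans (sym αʲ≡x) (trans (cong (_· α ^ j) α≡0) (zeroˡ _))) x≢0

  module Order (2<Q : 2 < Q) where
    n : ℕ
    n = Q ∸ 1

    Q≡1+n : Q ≡ suc n
    Q≡1+n = sym (ℕ.m+[n∸m]≡n {1} (ℕ.≤-trans (s≤s z≤n) 2<Q))

    instance
      n≢0 : NonZero n
      n≢0 = >-nonZero (ℕ.m<n⇒0<n∸m (ℕ.<-trans (ℕ.n<1+n 1) 2<Q))

    private
      α≢0′ : α ≢ 0#
      α≢0′ = α≢0 2<Q

      code : Carrier → Fin (suc n)
      code x = cast Q≡1+n (toFin x)

      code-injective : ∀ {x y} → code x ≡ code y → x ≡ y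
      code-injective {x} {y} eq = toFin-injective (Fin.toℕ-injective
        (trans (sym (Fin.toℕ-cast Q≡1+n (toFin x))) (trans (cong toℕ eq) (Fin.toℕ-cast Q≡1+n (toFin y)))))

      nonzero-code : (x : Carrier) → x ≢ 0# → Fin n
      nonzero-code x x≢0 = punchOut {i = code 0#} {j = code x} (x≢0 ∘ sym ∘ code-injective)

      nonzero-code-injective : ∀ {x y} (x≢0 : x ≢ 0#) (y≢0 : y ≢ 0#) →
                               nonzero-code x x≢0 ≡ nonzero-code y y≢0 → x ≡ y
      nonzero-code-injective x≢0 y≢0 =
        code-injective ∘ Fin.punchOut-injective (x≢0 ∘ sym ∘ code-injective) (y≢0 ∘ sym ∘ code-injective)

    powers-collide⇒α^n≡1 : ∀ {i j} → i < j → j ≤ n → α ^ i ≡ α ^ j → α ^ n ≡ 1#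
    powers-collide⇒α^n≡1 {i} {j} i<j j≤n αⁱ≡αʲ = subst (λ d → α ^ d ≡ 1#) (ℕ.≤-antisym d≤n n≤d) αᵈ≡1
      where
      d = j ∸ i
      αᵈ≡1 : α ^ d ≡ 1#
      αᵈ≡1 = x^i≡x^j⇒x^[j∸i]≡1 α≢0′ (ℕ.<⇒≤ i<j) αⁱ≡αʲ
      d≤n : d ≤ n
      d≤n = ℕ.≤-trans (ℕ.m∸n≤m j i) j≤n
      n≤d : n ≤ d
      n≤d = s≤s⁻¹ (subst (_≤ suc d) Q≡1+n (α^e≡1⇒Q≤1+e (ℕ.m<n⇒0<n∸m i<j) αᵈ≡1))

    -- The Q = n + 1 powers α⁰, …, αⁿ are nonzero, so two of them coincide.
    α^n≡1 : α ^ n ≡ 1#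
    α^n≡1 =
      let αᵏ≢0 = λ (k : Fin (suc n)) → ^-nonzero α≢0′ (toℕ k)
          (i , j , i<j , eq) = Fin.pigeonhole (ℕ.n<1+n n) λ k → nonzero-code (α ^ toℕ k) (αᵏ≢0 k)
      in powers-collide⇒α^n≡1 i<j (Fin.toℕ≤pred[n] j) (nonzero-code-injective (αᵏ≢0 i) (αᵏ≢0 j) eq)

    n∣e⇒α^e≡1 : ∀ {e} → n ∣ e → α ^ e ≡ 1#
    n∣e⇒α^e≡1 (divides k refl) =
      trans (cong (α ^_) (ℕ.*-comm k n)) (trans (^-assoc α n k) (trans (cong (_^ k) α^n≡1) (1^ k)))

    α^e≡1⇒n∣e : ∀ {e} → α ^ e ≡ 1# → n ∣ e
    α^e≡1⇒n∣e {e} α^e≡1 =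
      m%n≡0⇒n∣m e n (remainder≡0 (e % n) (m%n<n e n) (trans (sym (^-% α n α^n≡1 e)) α^e≡1))
      where
      remainder≡0 : ∀ r → r < n → α ^ r ≡ 1# → r ≡ 0
      remainder≡0 zero    _   _    = refl
      remainder≡0 (suc r) r<n αʳ≡1 =
        contradiction (α^e≡1⇒Q≤1+e (s≤s z≤n) αʳ≡1) (ℕ.<⇒≱ (subst (suc (suc r) <_) (sym Q≡1+n) (s≤s r<n)))

    α^e≡α⇒Q≤e : ∀ {e} → 1 < e → α ^ e ≡ α → Q ≤ e
    α^e≡α⇒Q≤e {suc e} (s≤s 0<e) α^e≡α =
      α^e≡1⇒Q≤1+e 0<e (x^i≡x^j⇒x^[j∸i]≡1 {i = 1} {suc e} α≢0′ (s≤s z≤n) (trans (*-identityʳ α) (sym α^e≡α)))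

    -- -1 is a power αʲ with α²ʲ = 1, so n ∣ 2j, and oddness of n forces αʲ = 1.
    characteristic-2 : Coprime n 2 → 1# + 1# ≡ 0#
    characteristic-2 n⊥2 with prim (- 1#) -1≢0
    ... | j , αʲ≡-1 = trans (cong (1# +_) (trans (sym αʲ≡1) αʲ≡-1)) (-‿inverseʳ 1#)
      where
      α²ʲ≡1 : α ^ (j *ℕ 2) ≡ 1#
      α²ʲ≡1 = trans (^-assoc α j 2) (trans (cong (_^ 2) αʲ≡-1) (trans (x^2≡x·x (- 1#)) -1·-1≡1))
      αʲ≡1 : α ^ j ≡ 1#
      αʲ≡1 = n∣e⇒α^e≡1 {j} (coprime-divisor n⊥2 (subst (n ∣_) (ℕ.*-comm j 2) (α^e≡1⇒n∣e {j *ℕ 2} α²ʲ≡1)))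

module Characteristic2 {Q : ℕ} (F : FiniteField Q)
                       (char-2 : FiniteField._+_ F (FiniteField.1# F) (FiniteField.1# F) ≡ FiniteField.0# F) where
  open FiniteFieldProperties F

  x+x≡0 : ∀ x → x + x ≡ 0#
  x+x≡0 x = trans (solve 1 (λ x → x :+ x := x :* (con 1 :+ con 1)) refl x) (trans (cong (x ·_) char-2) (zeroʳ x))

  x+y≡0⇒x≡y : ∀ {x y} → x + y ≡ 0# → x ≡ y
  x+y≡0⇒x≡y {x} {y} x+y≡0 = begin
    x             ≡⟨ sym (+-identityʳ x) ⟩
    x + 0#        ≡⟨ cong (x +_) (sym (x+x≡0 y)) ⟩
    x + (y + y)   ≡⟨ sym (+-assoc x y y) ⟩
    (x + y) + y   ≡⟨ cong (_+ y) x+y≡0 ⟩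
    0# + y        ≡⟨ +-identityˡ y ⟩
    y             ∎
    where open ≡-Reasoning

  ·ᵇ-xor : ∀ c d x → c ·ᵇ x + d ·ᵇ x ≡ (c xor d) ·ᵇ x
  ·ᵇ-xor true  true  x = x+x≡0 x
  ·ᵇ-xor true  false x = +-identityʳ x
  ·ᵇ-xor false d     x = +-identityˡ (d ·ᵇ x)

  +-square : ∀ x y → (x + y) · (x + y) ≡ x · x + y · y
  +-square x y = begin
    (x + y) · (x + y)                  ≡⟨ solve 2 (λ x y → (x :+ y) :* (x :+ y) :=
                                            (x :* x :+ y :* y) :+ (x :* y :+ x :* y)) refl x y ⟩
    (x · x + y · y) + (x · y + x · y)  ≡⟨ cong ((x · x + y · y) +_) (x+x≡0 (x · y)) ⟩
    (x · x + y · y) + 0#               ≡⟨ +-identityʳ _ ⟩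
    x · x + y · y                      ∎
    where open ≡-Reasoning

  frobenius : ∀ k x y → (x + y) ^ (2 ^ℕ k) ≡ x ^ (2 ^ℕ k) + y ^ (2 ^ℕ k)
  frobenius zero    x y = trans (*-identityʳ _) (sym (cong₂ _+_ (*-identityʳ x) (*-identityʳ y)))
  frobenius (suc k) x y = begin
    (x + y) ^ (2 *ℕ 2 ^ℕ k)                    ≡⟨ ^-assoc (x + y) 2 (2 ^ℕ k) ⟩
    ((x + y) ^ 2) ^ (2 ^ℕ k)                   ≡⟨ cong (_^ (2 ^ℕ k)) square ⟩
    (x ^ 2 + y ^ 2) ^ (2 ^ℕ k)                 ≡⟨ frobenius k (x ^ 2) (y ^ 2) ⟩
    (x ^ 2) ^ (2 ^ℕ k) + (y ^ 2) ^ (2 ^ℕ k)    ≡⟨ sym (cong₂ _+_ (^-assoc x 2 (2 ^ℕ k)) (^-assoc y 2 (2 ^ℕ k))) ⟩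
    x ^ (2 *ℕ 2 ^ℕ k) + y ^ (2 *ℕ 2 ^ℕ k)      ∎
    where
    open ≡-Reasoning
    square : (x + y) ^ 2 ≡ x ^ 2 + y ^ 2
    square = trans (x^2≡x·x (x + y)) (trans (+-square x y) (sym (cong₂ _+_ (x^2≡x·x x) (x^2≡x·x y))))

  Σ-frobenius : ∀ k {l} (f : Fin l → Carrier) → Σ[ f ] ^ (2 ^ℕ k) ≡ Σ[ (λ j → f j ^ (2 ^ℕ k)) ]
  Σ-frobenius k {zero}  f = 0^ (2 ^ℕ k) (ℕ.m^n>0 2 k)
  Σ-frobenius k {suc l} f =
    trans (frobenius k _ _) (cong (f Fin.zero ^ (2 ^ℕ k) +_) (Σ-frobenius k (f ∘ Fin.suc)))

  Σ-square : ∀ {l} (f : Fin l → Carrier) → Σ[ (λ j → f j · f j) ] ≡ Σ[ f ] · Σ[ f ]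
  Σ-square {zero}  f = sym (zeroˡ 0#)
  Σ-square {suc l} f =
    trans (cong (f Fin.zero · f Fin.zero +_) (Σ-square (f ∘ Fin.suc))) (sym (+-square _ _))

  InSubfield-·ᵇ : ∀ u c {x} → InSubfield u x → InSubfield u (c ·ᵇ x)
  InSubfield-·ᵇ u true  x∈K = x∈K
  InSubfield-·ᵇ u false _   = 0^ (2 ^ℕ u) (ℕ.m^n>0 2 u)

  InSubfield-Σ : ∀ u {l} {f : Fin l → Carrier} → (∀ j → InSubfield u (f j)) → InSubfield u Σ[ f ]
  InSubfield-Σ u {f = f} f∈K = trans (Σ-frobenius u f) (Σ-cong f∈K)

  module Coordinates {m : ℕ} (b : Fin m → Carrier) (rep : Carrier → Fin m → Bool)
                     (coordinates : IsCoordinates b rep) where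
    private
      combo-rep : ∀ x → combo b (rep x) ≡ x
      combo-rep = proj₁ coordinates

      rep-combo : ∀ c i → rep (combo b c) i ≡ c i
      rep-combo = proj₂ coordinates

    rep-injective : ∀ {x y} → (∀ i → rep x i ≡ rep y i) → x ≡ y
    rep-injective {x} {y} rep≗ =
      trans (sym (combo-rep x)) (trans (Σ-cong λ i → cong (_·ᵇ b i) (rep≗ i)) (combo-rep y))

    combo-xor : ∀ c d → combo b c + combo b d ≡ combo b (λ i → c i xor d i)
    combo-xor c d =
      trans (sym (Σ-distrib-+ (λ i → c i ·ᵇ b i) (λ i → d i ·ᵇ b i))) (Σ-cong λ i → ·ᵇ-xor (c i) (d i) (b i))

    rep-+ : ∀ x y i → rep (x + y) i ≡ rep x i xor rep y i
    rep-+ x y i = begin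
      rep (x + y) i                                ≡⟨ cong (λ z → rep z i) (cong₂ _+_ (sym (combo-rep x)) (sym (combo-rep y))) ⟩
      rep (combo b (rep x) + combo b (rep y)) i    ≡⟨ cong (λ z → rep z i) (combo-xor (rep x) (rep y)) ⟩
      rep (combo b (λ i → rep x i xor rep y i)) i  ≡⟨ rep-combo _ i ⟩
      rep x i xor rep y i                          ∎
      where open ≡-Reasoning

    rep-0 : ∀ i → rep 0# i ≡ false
    rep-0 i = trans (cong (λ z → rep z i) (sym (Σ-zero m))) (rep-combo (λ _ → false) i)

    rep-·ᵇ : ∀ c x i → rep (c ·ᵇ x) i ≡ rep x i ∧ c
    rep-·ᵇ true  x i = sym (Bool.∧-identityʳ _)
    rep-·ᵇ false x i = trans (rep-0 i) (sym (Bool.∧-zeroʳ _))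

    rep-Σ : ∀ {k} (y : Fin k → Carrier) (v : Fin k → Bool) i →
            fsum _xor_ false (λ j → rep (y j) i ∧ v j) ≡ rep Σ[ (λ j → v j ·ᵇ y j) ] i
    rep-Σ {zero}  y v i = sym (rep-0 i)
    rep-Σ {suc k} y v i =
      trans (cong₂ _xor_ (sym (rep-·ᵇ (v Fin.zero) (y Fin.zero) i)) (rep-Σ (y ∘ Fin.suc) (v ∘ Fin.suc) i))
            (sym (rep-+ _ _ i))

    MulVecZero⇔Σ≡0 : ∀ {k} (y : Fin k → Carrier) (v : Fin k → Bool) →
                     MulVecZero (λ i j → rep (y j) i) v ⇔ (Σ[ (λ j → v j ·ᵇ y j) ] ≡ 0#)
    MulVecZero⇔Σ≡0 y v = mk⇔
      (λ Hv≡0 → rep-injective λ i → trans (sym (rep-Σ y v i)) (trans (Hv≡0 i) (sym (rep-0 i))))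
      (λ Σ≡0 i → trans (rep-Σ y v i) (trans (cong (λ z → rep z i) Σ≡0) (rep-0 i)))

  module Conjugation (u : ℕ) (α : Carrier) (α^q≢α : α ^ (2 ^ℕ u) ≢ α) where
    q : ℕ
    q = 2 ^ℕ u

    β : Carrier
    β = α ^ q

    α+β≢0 : α + β ≢ 0#
    α+β≢0 = α^q≢α ∘ sym ∘ x+y≡0⇒x≡y

    module _ {a b : Carrier} (a∈K : InSubfield u a) (b∈K : InSubfield u b) where
      conjugate : (a + b · α) ^ q ≡ a + b · β
      conjugate = trans (frobenius u a (b · α)) (cong₂ _+_ a∈K (trans (^-distrib-· b α q) (cong (_· β) b∈K)))

      norm : (a + b · α) ^ (q +ℕ 1) ≡ (a · a + (α + β) · (a · b)) + (β · α) · (b · b)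
      norm = begin
        (a + b · α) ^ (q +ℕ 1)                             ≡⟨ ^-homo-· (a + b · α) q 1 ⟩
        (a + b · α) ^ q · (a + b · α) ^ 1                  ≡⟨ cong₂ _·_ conjugate (*-identityʳ _) ⟩
        (a + b · β) · (a + b · α)                          ≡⟨ solve 4 (λ a b α β → (a :+ b :* β) :* (a :+ b :* α) :=
                                                                (a :* a :+ (α :+ β) :* (a :* b)) :+ (β :* α) :* (b :* b)) refl a b α β ⟩
        (a · a + (α + β) · (a · b)) + (β · α) · (b · b)    ∎
        where open ≡-Reasoning

      -- Conjugating a + bα = 0 gives a + bβ = 0; the sum of the two is (α + β) b.
      coordinates-zero : a + b · α ≡ 0# → a ≡ 0# × b ≡ 0#
      coordinates-zero z≡0 = a≡0 , b≡0
        where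
        open ≡-Reasoning
        z̄≡0 : a + b · β ≡ 0#
        z̄≡0 = trans (sym conjugate) (trans (cong (_^ q) z≡0) (0^ q (ℕ.m^n>0 2 u)))
        [α+β]b≡0 : (α + β) · b ≡ 0#
        [α+β]b≡0 = begin
          (α + β) · b                    ≡⟨ sym (+-identityˡ _) ⟩
          0# + (α + β) · b               ≡⟨ cong (_+ (α + β) · b) (sym (x+x≡0 a)) ⟩
          (a + a) + (α + β) · b          ≡⟨ solve 4 (λ a b α β → (a :+ a) :+ (α :+ β) :* b :=
                                                (a :+ b :* α) :+ (a :+ b :* β)) refl a b α β ⟩
          (a + b · α) + (a + b · β)      ≡⟨ cong₂ _+_ z≡0 z̄≡0 ⟩
          0# + 0#                        ≡⟨ +-identityʳ 0# ⟩
          0#                             ∎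
        b≡0 : b ≡ 0#
        b≡0 = x·y≡0⇒y≡0 α+β≢0 [α+β]b≡0
        a≡0 : a ≡ 0#
        a≡0 = begin
          a               ≡⟨ sym (+-identityʳ a) ⟩
          a + 0#          ≡⟨ cong (a +_) (sym (zeroˡ α)) ⟩
          a + 0# · α      ≡⟨ cong (λ t → a + t · α) (sym b≡0) ⟩
          a + b · α       ≡⟨ z≡0 ⟩
          0#              ∎

    module _ {k : ℕ} (a b : Fin k → Carrier)
             (a∈K : ∀ j → InSubfield u (a j)) (b∈K : ∀ j → InSubfield u (b j)) where
      Σ-coordinates : Σ[ (λ j → a j + b j · α) ] ≡ Σ[ a ] + Σ[ b ] · α
      Σ-coordinates = trans (Σ-distrib-+ a (λ j → b j · α)) (cong (Σ[ a ] +_) (Σ-distribʳ-· α b))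

      Σ-norm : Σ[ (λ j → (a j + b j · α) ^ (q +ℕ 1)) ] ≡
               (Σ[ a ] · Σ[ a ] + (α + β) · Σ[ (λ j → a j · b j) ]) + (β · α) · (Σ[ b ] · Σ[ b ])
      Σ-norm = begin
        Σ[ (λ j → (a j + b j · α) ^ (q +ℕ 1)) ]
          ≡⟨ Σ-cong (λ j → norm (a∈K j) (b∈K j)) ⟩
        Σ[ (λ j → (a j · a j + t · (a j · b j)) + N · (b j · b j)) ]
          ≡⟨ Σ-distrib-+ (λ j → a j · a j + t · (a j · b j)) (λ j → N · (b j · b j)) ⟩
        Σ[ (λ j → a j · a j + t · (a j · b j)) ] + Σ[ (λ j → N · (b j · b j)) ]
          ≡⟨ cong₂ _+_ (Σ-distrib-+ (λ j → a j · a j) (λ j → t · (a j · b j))) (Σ-distribˡ-· N (λ j → b j · b j)) ⟩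
        (Σ[ (λ j → a j · a j) ] + Σ[ (λ j → t · (a j · b j)) ]) + N · Σ[ (λ j → b j · b j) ]
          ≡⟨ cong₂ (λ x y → (x + y) + N · Σ[ (λ j → b j · b j) ]) (Σ-square a) (Σ-distribˡ-· t (λ j → a j · b j)) ⟩
        (Σ[ a ] · Σ[ a ] + t · Σ[ (λ j → a j · b j) ]) + N · Σ[ (λ j → b j · b j) ]
          ≡⟨ cong (λ y → (Σ[ a ] · Σ[ a ] + t · Σ[ (λ j → a j · b j) ]) + N · y) (Σ-square b) ⟩
        (Σ[ a ] · Σ[ a ] + t · Σ[ (λ j → a j · b j) ]) + N · (Σ[ b ] · Σ[ b ])
          ∎
        where
        open ≡-Reasoning
        t = α + β
        N = β · α

      Σ-norm≡0⇔Σ-product≡0 : Σ[ (λ j → a j + b j · α) ] ≡ 0# →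
        (Σ[ (λ j → (a j + b j · α) ^ (q +ℕ 1)) ] ≡ 0# ⇔ Σ[ (λ j → a j · b j) ] ≡ 0#)
      Σ-norm≡0⇔Σ-product≡0 Σz≡0 = mk⇔
        (x·y≡0⇒y≡0 α+β≢0 ∘ trans (sym Σ-norm≡trace·S))
        (λ S≡0 → trans Σ-norm≡trace·S (trans (cong ((α + β) ·_) S≡0) (zeroʳ _)))
        where
        S = Σ[ (λ j → a j · b j) ]
        A≡0×B≡0 : Σ[ a ] ≡ 0# × Σ[ b ] ≡ 0#
        A≡0×B≡0 = coordinates-zero (InSubfield-Σ u a∈K) (InSubfield-Σ u b∈K) (trans (sym Σ-coordinates) Σz≡0)
        Σ-norm≡trace·S : Σ[ (λ j → (a j + b j · α) ^ (q +ℕ 1)) ] ≡ (α + β) · S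
        Σ-norm≡trace·S = trans Σ-norm
          (trans (cong₂ (λ A B → (A · A + (α + β) · S) + (β · α) · (B · B)) (proj₁ A≡0×B≡0) (proj₂ A≡0×B≡0))
                 (solve 3 (λ t S N → (con 0 :* con 0 :+ t :* S) :+ N :* (con 0 :* con 0) := t :* S) refl (α + β) S (β · α)))

    module _ {k : ℕ} (γ₁ γ₂ : Fin k → Carrier)
             (γ₁∈K : ∀ j → InSubfield u (γ₁ j)) (γ₂∈K : ∀ j → InSubfield u (γ₂ j)) (v : Fin k → Bool) where
      private
        a c : Fin k → Carrier
        a j = v j ·ᵇ γ₁ j
        c j = v j ·ᵇ γ₂ j

        selected : ∀ j → v j ·ᵇ (γ₁ j + γ₂ j · α) ≡ a j + c j · α
        selected j = trans (·ᵇ-distrib-+ (v j) _ _) (cong (a j +_) (·ᵇ-assoc (v j) (γ₂ j) α))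

        selected^[q+1] : ∀ j → v j ·ᵇ (γ₁ j + γ₂ j · α) ^ (q +ℕ 1) ≡ (a j + c j · α) ^ (q +ℕ 1)
        selected^[q+1] j = trans (·ᵇ-^ (v j) _ (q +ℕ 1) (ℕ.m≤n+m 1 q)) (cong (_^ (q +ℕ 1)) (selected j))

      Σ-support-norm≡0⇔Σ-support-product≡0 : Σ[ (λ j → v j ·ᵇ (γ₁ j + γ₂ j · α)) ] ≡ 0# →
        (Σ[ (λ j → v j ·ᵇ (γ₁ j + γ₂ j · α) ^ (q +ℕ 1)) ] ≡ 0# ⇔ Σ[ (λ j → v j ·ᵇ (γ₁ j · γ₂ j)) ] ≡ 0#)
      Σ-support-norm≡0⇔Σ-support-product≡0 Σ≡0 =
        ⇔.trans (≡0⇔≡0 (Σ-cong selected^[q+1])) (⇔.trans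
          (Σ-norm≡0⇔Σ-product≡0 a c (λ j → InSubfield-·ᵇ u (v j) (γ₁∈K j)) (λ j → InSubfield-·ᵇ u (v j) (γ₂∈K j))
                                  (trans (sym (Σ-cong selected)) Σ≡0))
          (≡0⇔≡0 (sym (Σ-cong λ j → ·ᵇ-distrib-· (v j) (γ₁ j) (γ₂ j)))))

2≤2^[1+k] : ∀ k → 2 ≤ 2 ^ℕ suc k
2≤2^[1+k] k = ℕ.*-monoʳ-≤ 2 (ℕ.m^n>0 2 k)

2^[2*k]≡2^k*2^k : ∀ k → 2 ^ℕ (2 *ℕ k) ≡ 2 ^ℕ k *ℕ 2 ^ℕ k
2^[2*k]≡2^k*2^k k = trans (cong (λ e → 2 ^ℕ (k +ℕ e)) (ℕ.+-identityʳ k)) (ℕ.^-distribˡ-+-* 2 k k)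

1+p*2-coprime-2 : ∀ p → Coprime (suc (p *ℕ 2)) 2
1+p*2-coprime-2 zero    = 1-coprimeTo 2
1+p*2-coprime-2 (suc p) = coprime-+ (1+p*2-coprime-2 p)

2^m∸1-coprime-2 : ∀ m → 0 < m → Coprime (2 ^ℕ m ∸ 1) 2
2^m∸1-coprime-2 (suc k) _ =
  subst (λ n → Coprime n 2) (sym (2*p∸1≡1+[p∸1]*2 (2 ^ℕ k) (ℕ.m^n>0 2 k))) (1+p*2-coprime-2 (2 ^ℕ k ∸ 1))
  where
  2*p∸1≡1+[p∸1]*2 : ∀ p → 0 < p → 2 *ℕ p ∸ 1 ≡ suc ((p ∸ 1) *ℕ 2)
  2*p∸1≡1+[p∸1]*2 (suc p) _ = trans (ℕ.+-suc p (p +ℕ 0)) (cong suc (ℕ.*-comm 2 p))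

lemma7 : (u : ℕ) → 1 ≤ u →
    let m = 2 *ℕ u
        n = 2 ^ℕ m ∸ 1
        r = 2 ^ℕ u +ℕ 1
    in (F : FiniteField (2 ^ℕ m)) →
    let open FiniteField F
    in (α : Carrier) → Primitive α →
       (γ₁ γ₂ : Fin n → Carrier) →
       (∀ j → InSubfield u (γ₁ j)) → (∀ j → InSubfield u (γ₂ j)) →
       (∀ j → α ^ toℕ j ≡ γ₁ j + γ₂ j · α) →
       (b : Fin m → Carrier) (rep : Carrier → Fin m → Bool) → IsCoordinates b rep →
    let H : Fin m → Fin n → Bool
        H i j = rep (α ^ toℕ j) i
        E : Fin m → Fin n → Bool
        E i j = rep (α ^ (toℕ j *ℕ r)) i
        S : (Fin n → Bool) → Carrier
        S v = Σ[ (λ j → if v j then γ₁ j · γ₂ j else 0#) ]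
    in (v : Fin n → Bool) →
       (MulVecZero H v × MulVecZero E v) ⇔ (MulVecZero H v × S v ≡ 0#)
lemma7 (suc u) _ F α prim γ₁ γ₂ γ₁∈K γ₂∈K αʲ≡γ₁+γ₂α basis rep coordinates v =
  mk⇔ (λ (Hv , Ev) → Hv , Equivalence.to (norm⇔product Hv) (Equivalence.to E⇔ Ev))
      (λ (Hv , S≡0) → Hv , Equivalence.from E⇔ (Equivalence.from (norm⇔product Hv) S≡0))
  where
  open FiniteFieldProperties F
  q = 2 ^ℕ suc u
  r = q +ℕ 1

  q<Q : q < 2 ^ℕ (2 *ℕ suc u)
  q<Q = subst (q <_) (sym (2^[2*k]≡2^k*2^k (suc u))) (ℕ.m<m*n q q {{ℕ.m^n≢0 2 (suc u)}} (2≤2^[1+k] u))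

  open PrimitiveElement F α prim
  open Order (ℕ.≤-<-trans (2≤2^[1+k] u) q<Q)
  open Characteristic2 F (characteristic-2 (2^m∸1-coprime-2 (2 *ℕ suc u) (s≤s z≤n)))
  open Coordinates basis rep coordinates
  open Conjugation (suc u) α (ℕ.<⇒≱ q<Q ∘ α^e≡α⇒Q≤e (2≤2^[1+k] u))
    using (Σ-support-norm≡0⇔Σ-support-product≡0)

  H⇔ : MulVecZero (λ i j → rep (α ^ toℕ j) i) v ⇔ (Σ[ (λ j → v j ·ᵇ (γ₁ j + γ₂ j · α)) ] ≡ 0#)
  H⇔ = ⇔.trans (MulVecZero⇔Σ≡0 (λ j → α ^ toℕ j) v)
                (≡0⇔≡0 (Σ-cong λ j → cong (v j ·ᵇ_) (αʲ≡γ₁+γ₂α j)))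

  E⇔ : MulVecZero (λ i j → rep (α ^ (toℕ j *ℕ r)) i) v ⇔ (Σ[ (λ j → v j ·ᵇ (γ₁ j + γ₂ j · α) ^ r) ] ≡ 0#)
  E⇔ = ⇔.trans (MulVecZero⇔Σ≡0 (λ j → α ^ (toℕ j *ℕ r)) v)
                (≡0⇔≡0 (Σ-cong λ j → cong (v j ·ᵇ_) (trans (^-assoc α (toℕ j) r) (cong (_^ r) (αʲ≡γ₁+γ₂α j)))))

  norm⇔product : MulVecZero (λ i j → rep (α ^ toℕ j) i) v →
                 (Σ[ (λ j → v j ·ᵇ (γ₁ j + γ₂ j · α) ^ r) ] ≡ 0#) ⇔ (Σ[ (λ j → v j ·ᵇ (γ₁ j · γ₂ j)) ] ≡ 0#)
  norm⇔product = Σ-support-norm≡0⇔Σ-support-product≡0 γ₁ γ₂ γ₁∈K γ₂∈K v ∘ Equivalence.to H⇔
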